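{- Let $0<\delta<\frac12$, and let $T_0$ be an $N_0$-vertex tournament which is $\delta^2$-close to transitive. Then there exist an integer $N\geq(1-\delta)N_0$, an $N$-vertex subtournament $T$ of $T_0$, and an ordered graph $G$ on the vertex set of $T$ such that $G$ is consistent with $T$ and every vertex of $G$ has at most $4\delta N$ non-neighbors in $G$.
   Context: An $N$-vertex tournament is $\delta$-close to transitive if it can be made transitive by reversing the orientation of at most $\delta N^2$ edges. An ordered graph is a graph with a linear order $\prec$ on its vertex set. An ordered graph $G$ is consistent with a tournament $T$ on the same vertex set if for all $v\prec w$, $vw\in E(G)$ if and only if the edge between $v$ and $w$ is oriented $v\to w$ in $T$. -}

module Defs where

open import Data.Bool using (Bool; true; false; not; _∧_; _xor_)
open import Data.Nat as ℕ using (ℕ; zero; suc; _+_)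
open import Data.Fin as Fin using (Fin; toℕ)
open import Data.Fin.Properties using () renaming (_≟_ to _≟ᶠ_)
open import Data.Integer using (+_)
open import Data.Rational using (ℚ; _/_; _≤_; _*_)
open import Relation.Binary.PropositionalEquality using (_≡_; _≢_)
open import Relation.Nullary using (does)
open import Function.Definitions using (Injective)

ℕ→ℚ : ℕ → ℚ
ℕ→ℚ n = + n / 1

sumFin : ∀ {n} → (Fin n → ℕ) → ℕ
sumFin {zero}  f = 0
sumFin {suc n} f = f Fin.zero + sumFin (λ i → f (Fin.suc i))

bool→ℕ : Bool → ℕ
bool→ℕ true  = 1
bool→ℕ false = 0

count : ∀ {n} → (Fin n → Bool) → ℕ
count P = sumFin (λ i → bool→ℕ (P i))

-- a tournament on vertex set Fin n: edge i j ≡ true means the edge is oriented i → j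
record Tournament (n : ℕ) : Set where
  field
    edge   : Fin n → Fin n → Bool
    irrefl : ∀ i → edge i i ≡ false
    tourn  : ∀ i j → i ≢ j → edge i j ≡ not (edge j i)
open Tournament public

Transitive : ∀ {n} → Tournament n → Set
Transitive T = ∀ i j k → edge T i j ≡ true → edge T j k ≡ true → edge T i k ≡ true

distance : ∀ {n} → Tournament n → Tournament n → ℕ
distance T T' = sumFin (λ i → count (λ j → does (toℕ i ℕ.<? toℕ j) ∧ (edge T i j xor edge T' i j)))

CloseToTransitive : ∀ {N} → ℚ → Tournament N → Set
CloseToTransitive {N} ε T =
  Σ' (Tournament N) (λ T' → Transitive T' ×' (ℕ→ℚ (distance T T') ≤ ε * ℕ→ℚ (N ℕ.* N)))
  where
  open import Data.Product using () renaming (Σ to Σ'; _×_ to _×'_)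

induced : ∀ {N N₀} → (T : Tournament N₀) → (f : Fin N → Fin N₀) → Injective _≡_ _≡_ f → Tournament N
induced T f inj = record
  { edge   = λ v w → edge T (f v) (f w)
  ; irrefl = λ v → irrefl T (f v)
  ; tourn  = λ v w v≢w → tourn T (f v) (f w) (λ eq → v≢w (inj eq))
  }

-- an ordered graph on vertex set Fin n: a simple graph together with a linear
-- order ≺, given by an injective ranking rank : Fin n → Fin n (v ≺ w iff rank v < rank w)
record OrderedGraph (n : ℕ) : Set where
  field
    adj     : Fin n → Fin n → Bool
    adjSym  : ∀ v w → adj v w ≡ adj w v
    adjIrr  : ∀ v → adj v v ≡ false
    rank    : Fin n → Fin n
    rankInj : Injective _≡_ _≡_ rank
open OrderedGraph public

_≺[_]_ : ∀ {n} → Fin n → OrderedGraph n → Fin n → Set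
v ≺[ G ] w = rank G v Fin.< rank G w

Consistent : ∀ {n} → OrderedGraph n → Tournament n → Set
Consistent G T = ∀ v w → v ≺[ G ] w → adj G v w ≡ edge T v w

nonNeighbours : ∀ {n} → OrderedGraph n → Fin n → ℕ
nonNeighbours G v = count (λ w → not (does (v ≟ᶠ w)) ∧ not (adj G v w))

{-# OPTIONS --safe #-}

-- Let S be a transitive tournament at distance D ≤ δ²N₀² from T₀, and let the disagreement
-- degree of a vertex v be the number of w on which T₀ and S orient vw differently; these
-- degrees sum to 2D. Keep only the vertices of disagreement degree at most K = ⌊2δN₀⌋: by
-- Markov's inequality at most 2D/(K+1) ≤ δN₀ vertices are deleted. Order the survivors along S
-- and join v and w exactly when T₀ and S agree on vw. This ordered graph is consistent with T₀,
-- and every vertex has at most K ≤ 2δN₀ ≤ 4δN non-neighbours, since N ≥ (1 - δ)N₀ ≥ N₀/2.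
module Submission where

open import Defs
open import Data.Bool using (Bool; true; false; not; _∧_; _xor_)
open import Data.Bool.Properties using (not-involutive; not-distribʳ-xor; xor-identityʳ; xor-annihilates-not)
open import Data.Nat as ℕ using (ℕ; zero; suc; _+_; _*_; _∸_; _≤_; _<_; _≤?_; _<?_; z≤n; NonZero)
open import Data.Nat.Properties
open import Data.Nat.DivMod using (m≡m%n+[m/n]*n; m%n<n; m/n*n≤m)
open import Data.Nat.Tactic.RingSolver using (solve-∀)
open import Algebra.Properties.CommutativeSemigroup +-commutativeSemigroup using (interchange)
open import Algebra.Properties.CommutativeSemigroup *-commutativeSemigroup using () renaming (interchange to *-interchange)
open import Data.Fin using (Fin; zero; suc; toℕ; fromℕ<) renaming (_<_ to _<ᶠ_)
import Data.Fin.Properties as Finₚ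
open Finₚ using (toℕ-fromℕ<; toℕ-injective) renaming (_≟_ to _≟ᶠ_)
open import Data.Vec.Functional using (_∷_)
open import Data.Product using (Σ; _×_; _,_)
open import Function using (_∘_)
open import Function.Definitions using (Injective)
open import Relation.Nullary using (Dec; yes; no; does; ¬_; contradiction)
open import Relation.Nullary.Decidable using (dec-true; dec-false)
open import Relation.Binary.PropositionalEquality

sumFin-cong : ∀ {n} {f g : Fin n → ℕ} → (∀ i → f i ≡ g i) → sumFin f ≡ sumFin g
sumFin-cong {zero}  f≗g = refl
sumFin-cong {suc n} f≗g = cong₂ _+_ (f≗g zero) (sumFin-cong (f≗g ∘ suc))

sumFin-mono-≤ : ∀ {n} {f g : Fin n → ℕ} → (∀ i → f i ≤ g i) → sumFin f ≤ sumFin g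
sumFin-mono-≤ {zero}  f≤g = z≤n
sumFin-mono-≤ {suc n} f≤g = +-mono-≤ (f≤g zero) (sumFin-mono-≤ (f≤g ∘ suc))

sumFin-mono-< : ∀ {n} {f g : Fin n → ℕ} → (∀ i → f i ≤ g i) → ∀ j → f j < g j → sumFin f < sumFin g
sumFin-mono-< f≤g zero    fj<gj = +-mono-<-≤ fj<gj (sumFin-mono-≤ (f≤g ∘ suc))
sumFin-mono-< f≤g (suc j) fj<gj = +-mono-≤-< (f≤g zero) (sumFin-mono-< (f≤g ∘ suc) j fj<gj)

sumFin-zero : ∀ n → sumFin {n} (λ _ → 0) ≡ 0
sumFin-zero zero    = refl
sumFin-zero (suc n) = sumFin-zero n

sumFin-distrib-+ : ∀ {n} (f g : Fin n → ℕ) → sumFin (λ i → f i + g i) ≡ sumFin f + sumFin g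
sumFin-distrib-+ {zero}  f g = refl
sumFin-distrib-+ {suc n} f g =
  trans (cong (f zero + g zero +_) (sumFin-distrib-+ (f ∘ suc) (g ∘ suc)))
        (interchange (f zero) (g zero) _ _)

sumFin-comm : ∀ {m n} (f : Fin m → Fin n → ℕ) →
  sumFin (λ i → sumFin (f i)) ≡ sumFin (λ j → sumFin (λ i → f i j))
sumFin-comm {zero}  {n} f = sym (sumFin-zero n)
sumFin-comm {suc m} f =
  trans (cong (sumFin (f zero) +_) (sumFin-comm (f ∘ suc)))
        (sym (sumFin-distrib-+ (f zero) _))

*-distribˡ-sumFin : ∀ {n} c (f : Fin n → ℕ) → c * sumFin f ≡ sumFin (λ i → c * f i)
*-distribˡ-sumFin {zero}  c f = *-zeroʳ c
*-distribˡ-sumFin {suc n} c f =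
  trans (*-distribˡ-+ c (f zero) _) (cong (c * f zero +_) (*-distribˡ-sumFin c (f ∘ suc)))

does≡true⇒ : ∀ {a} {A : Set a} (a? : Dec A) → does a? ≡ true → A
does≡true⇒ (yes a) _ = a

not-does≡true⇒¬ : ∀ {a} {A : Set a} (a? : Dec A) → not (does a?) ≡ true → ¬ A
not-does≡true⇒¬ (no ¬a) _ = ¬a

bool→ℕ-mono-≤ : ∀ {x y} → (x ≡ true → y ≡ true) → bool→ℕ x ≤ bool→ℕ y
bool→ℕ-mono-≤ {false} x⇒y = z≤n
bool→ℕ-mono-≤ {true}  x⇒y rewrite x⇒y refl = ≤-refl

count-true : ∀ n → count {n} (λ _ → true) ≡ n
count-true zero    = refl
count-true (suc n) = cong suc (count-true n)

count-complement : ∀ {n} (P : Fin n → Bool) → count P + count (not ∘ P) ≡ n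
count-complement {n} P = begin
  count P + count (not ∘ P)                ≡⟨ sumFin-distrib-+ (bool→ℕ ∘ P) (bool→ℕ ∘ not ∘ P) ⟨
  sumFin (λ i → bool→ℕ (P i) + bool→ℕ (not (P i)))  ≡⟨ sumFin-cong (λ i → one (P i)) ⟩
  count {n} (λ _ → true)                   ≡⟨ count-true n ⟩
  n                                        ∎
  where
  open ≡-Reasoning
  one : ∀ x → bool→ℕ x + bool→ℕ (not x) ≡ 1
  one true  = refl
  one false = refl

count-mono-≤ : ∀ {n} {P Q : Fin n → Bool} → (∀ i → P i ≡ true → Q i ≡ true) → count P ≤ count Q
count-mono-≤ P⇒Q = sumFin-mono-≤ (λ i → bool→ℕ-mono-≤ (P⇒Q i))

count-mono-< : ∀ {n} {P Q : Fin n → Bool} → (∀ i → P i ≡ true → Q i ≡ true) →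
  ∀ j → P j ≡ false → Q j ≡ true → count P < count Q
count-mono-< P⇒Q j Pj≡false Qj≡true =
  sumFin-mono-< (λ i → bool→ℕ-mono-≤ (P⇒Q i)) j
    (subst₂ (λ x y → bool→ℕ x < bool→ℕ y) (sym Pj≡false) (sym Qj≡true) ≤-refl)

count<n : ∀ {n} (P : Fin n → Bool) j → P j ≡ false → count P < n
count<n {n} P j Pj≡false =
  subst (count P <_) (count-true n) (count-mono-< (λ _ _ → refl) j Pj≡false refl)

markov : ∀ {n} (w : Fin n → ℕ) (P : Fin n → Bool) K →
  (∀ i → P i ≡ true → suc K ≤ w i) → suc K * count P ≤ sumFin w
markov w P K P⇒K<w = begin
  suc K * count P                            ≡⟨ *-distribˡ-sumFin (suc K) (bool→ℕ ∘ P) ⟩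
  sumFin (λ i → suc K * bool→ℕ (P i))        ≤⟨ sumFin-mono-≤ (λ i → pointwise (P i) (P⇒K<w i)) ⟩
  sumFin w                                   ∎
  where
  open ≤-Reasoning
  pointwise : ∀ {m} x → (x ≡ true → suc K ≤ m) → suc K * bool→ℕ x ≤ m
  pointwise true  x⇒K<m = ≤-trans (≤-reflexive (*-identityʳ (suc K))) (x⇒K<m refl)
  pointwise false _     = ≤-trans (≤-reflexive (*-zeroʳ (suc K))) z≤n

enumerate : ∀ {n} (P : Fin n → Bool) → Fin (count P) → Fin n
enumerate {zero}  P = λ ()
enumerate {suc n} P with P zero
... | true  = zero ∷ suc ∘ enumerate (P ∘ suc)
... | false = suc ∘ enumerate (P ∘ suc)

enumerate-injective : ∀ {n} (P : Fin n → Bool) → Injective _≡_ _≡_ (enumerate P)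
enumerate-injective {suc n} P {i} {j} eq with P zero
enumerate-injective {suc n} P {zero}  {zero}  eq | true = refl
enumerate-injective {suc n} P {suc i} {suc j} eq | true =
  cong suc (enumerate-injective (P ∘ suc) (Finₚ.suc-injective eq))
enumerate-injective {suc n} P {i} {j} eq | false =
  enumerate-injective (P ∘ suc) (Finₚ.suc-injective eq)

enumerate-sound : ∀ {n} (P : Fin n → Bool) i → P (enumerate P i) ≡ true
enumerate-sound {suc n} P i with P zero in P0
enumerate-sound {suc n} P zero    | true  = P0
enumerate-sound {suc n} P (suc i) | true  = enumerate-sound (P ∘ suc) i
enumerate-sound {suc n} P i       | false = enumerate-sound (P ∘ suc) i

sumFin-enumerate-≤ : ∀ {n} (P : Fin n → Bool) (f : Fin n → ℕ) → sumFin (f ∘ enumerate P) ≤ sumFin f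
sumFin-enumerate-≤ {zero}  P f = z≤n
sumFin-enumerate-≤ {suc n} P f with P zero
... | true  = +-monoʳ-≤ (f zero) (sumFin-enumerate-≤ (P ∘ suc) (f ∘ suc))
... | false = ≤-trans (sumFin-enumerate-≤ (P ∘ suc) (f ∘ suc)) (m≤n+m _ (f zero))

-- Ranking a transitive tournament by in-degree

edge-reverse : ∀ {n} (T : Tournament n) {v w} → v ≢ w → edge T v w ≡ false → edge T w v ≡ true
edge-reverse T v≢w vw≡false = trans (tourn T _ _ (v≢w ∘ sym)) (cong not vw≡false)

indegree : ∀ {n} → Tournament n → Fin n → ℕ
indegree T v = count (λ u → edge T u v)

indegree<n : ∀ {n} (T : Tournament n) v → indegree T v < n
indegree<n T v = count<n _ v (irrefl T v)

indegreeRank : ∀ {n} → Tournament n → Fin n → Fin n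
indegreeRank T v = fromℕ< (indegree<n T v)

toℕ-indegreeRank : ∀ {n} (T : Tournament n) v → toℕ (indegreeRank T v) ≡ indegree T v
toℕ-indegreeRank T v = toℕ-fromℕ< (indegree<n T v)

module _ {n} (T : Tournament n) (T-transitive : Transitive T) where

  indegree-mono : ∀ {v w} → edge T v w ≡ true → indegree T v < indegree T w
  indegree-mono {v} {w} vw = count-mono-< (λ u uv → T-transitive u v w uv vw) v (irrefl T v) vw

  edge-indegree< : ∀ {v w} → indegree T v < indegree T w → edge T v w ≡ true
  edge-indegree< {v} {w} lt with edge T v w in vw | v ≟ᶠ w
  ... | true  | _        = refl
  ... | false | yes refl = contradiction lt (<-irrefl refl)
  ... | false | no v≢w   = contradiction lt (<-asym (indegree-mono (edge-reverse T v≢w vw)))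

  indegree-injective : Injective _≡_ _≡_ (indegree T)
  indegree-injective {v} {w} eq with v ≟ᶠ w | edge T v w in vw
  ... | yes v≡w | _     = v≡w
  ... | no v≢w  | true  = contradiction eq (<⇒≢ (indegree-mono vw))
  ... | no v≢w  | false = contradiction (sym eq) (<⇒≢ (indegree-mono (edge-reverse T v≢w vw)))

  indegreeRank-injective : Injective _≡_ _≡_ (indegreeRank T)
  indegreeRank-injective {v} {w} eq = indegree-injective (trans (sym (toℕ-indegreeRank T v)) (trans (cong toℕ eq) (toℕ-indegreeRank T w)))

  edge-indegreeRank< : ∀ {v w} → indegreeRank T v <ᶠ indegreeRank T w → edge T v w ≡ true
  edge-indegreeRank< {v} {w} lt = edge-indegree< (subst₂ _<_ (toℕ-indegreeRank T v) (toℕ-indegreeRank T w) lt)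

-- The agreement graph of a tournament with a transitive tournament

≺⇒≢ : ∀ {n} (G : OrderedGraph n) {v w} → v ≺[ G ] w → v ≢ w
≺⇒≢ G v≺w refl = <-irrefl refl v≺w

module _ {n} (T S : Tournament n) where

  disagree : Fin n → Fin n → Bool
  disagree v w = edge T v w xor edge S v w

  disagree-irrefl : ∀ v → disagree v v ≡ false
  disagree-irrefl v = cong₂ _xor_ (irrefl T v) (irrefl S v)

  disagree-sym : ∀ {v w} → v ≢ w → disagree v w ≡ disagree w v
  disagree-sym {v} {w} v≢w = begin
    edge T v w xor edge S v w              ≡⟨ xor-annihilates-not (edge T v w) (edge S v w) ⟨
    not (edge T v w) xor not (edge S v w)  ≡⟨ cong₂ _xor_ (tourn T w v (v≢w ∘ sym)) (tourn S w v (v≢w ∘ sym)) ⟨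
    edge T w v xor edge S w v              ∎
    where open ≡-Reasoning

  disagreeForward : Fin n → Fin n → Bool
  disagreeForward v w = does (toℕ v <? toℕ w) ∧ disagree v w

  disagree-split : ∀ v w →
    bool→ℕ (disagree v w) ≡ bool→ℕ (disagreeForward v w) + bool→ℕ (disagreeForward w v)
  disagree-split v w = split (toℕ v <? toℕ w) (toℕ w <? toℕ v)
    where
    split : (v<?w : Dec (toℕ v < toℕ w)) (w<?v : Dec (toℕ w < toℕ v)) →
      bool→ℕ (disagree v w) ≡ bool→ℕ (does v<?w ∧ disagree v w) + bool→ℕ (does w<?v ∧ disagree w v)
    split (yes v<w) (yes w<v) = contradiction w<v (<-asym v<w)
    split (yes _)   (no _)    = sym (+-identityʳ _)
    split (no _)    (yes w<v) = cong bool→ℕ (disagree-sym λ v≡w → <-irrefl (cong toℕ (sym v≡w)) w<v)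
    split (no v≮w)  (no w≮v)  = cong bool→ℕ (subst (λ u → disagree v u ≡ false) v≡w (disagree-irrefl v))
      where
      v≡w : v ≡ w
      v≡w = toℕ-injective (≤-antisym (≮⇒≥ w≮v) (≮⇒≥ v≮w))

  sumFin-count-disagree : sumFin (λ v → count (disagree v)) ≡ distance T S + distance T S
  sumFin-count-disagree = begin
    sumFin (λ v → count (disagree v))
      ≡⟨ sumFin-cong (λ v → trans (sumFin-cong (disagree-split v))
                                  (sumFin-distrib-+ (bool→ℕ ∘ disagreeForward v) _)) ⟩
    sumFin (λ v → count (disagreeForward v) + sumFin (λ w → bool→ℕ (disagreeForward w v)))
      ≡⟨ sumFin-distrib-+ (count ∘ disagreeForward) _ ⟩
    distance T S + sumFin (λ v → sumFin (λ w → bool→ℕ (disagreeForward w v)))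
      ≡⟨ cong (distance T S +_) (sumFin-comm (λ v w → bool→ℕ (disagreeForward w v))) ⟩
    distance T S + distance T S
      ∎
    where open ≡-Reasoning

  agree : Fin n → Fin n → Bool
  agree v w = not (does (v ≟ᶠ w)) ∧ not (disagree v w)

  agree-sym : ∀ v w → agree v w ≡ agree w v
  agree-sym v w with v ≟ᶠ w | w ≟ᶠ v
  ... | yes _   | yes _   = refl
  ... | no v≢w  | no _    = cong not (disagree-sym v≢w)
  ... | yes v≡w | no w≢v  = contradiction (sym v≡w) w≢v
  ... | no v≢w  | yes w≡v = contradiction (sym w≡v) v≢w

  agree-irrefl : ∀ v → agree v v ≡ false
  agree-irrefl v rewrite dec-true (v ≟ᶠ v) refl = refl

  agreementGraph : Transitive S → OrderedGraph n
  agreementGraph S-transitive = record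
    { adj     = agree
    ; adjSym  = agree-sym
    ; adjIrr  = agree-irrefl
    ; rank    = indegreeRank S
    ; rankInj = indegreeRank-injective S S-transitive
    }

  module _ (S-transitive : Transitive S) where

    agreementGraph-consistent : Consistent (agreementGraph S-transitive) T
    agreementGraph-consistent v w v≺w = begin
      not (does (v ≟ᶠ w)) ∧ not (edge T v w xor edge S v w)
        ≡⟨ cong₂ (λ d x → not d ∧ not (edge T v w xor x))
                 (dec-false (v ≟ᶠ w) (≺⇒≢ (agreementGraph S-transitive) v≺w))
                 (edge-indegreeRank< S S-transitive v≺w) ⟩
      not (edge T v w xor true)  ≡⟨ not-distribʳ-xor (edge T v w) true ⟩
      edge T v w xor false       ≡⟨ xor-identityʳ (edge T v w) ⟩
      edge T v w                 ∎
      where open ≡-Reasoning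

    nonNeighbours-agreementGraph : ∀ v → nonNeighbours (agreementGraph S-transitive) v ≤ count (disagree v)
    nonNeighbours-agreementGraph v = count-mono-≤ (λ w → nonAdjacent⇒disagree (does (v ≟ᶠ w)) (disagree v w))
      where
      nonAdjacent⇒disagree : ∀ d x → not d ∧ not (not d ∧ not x) ≡ true → x ≡ true
      nonAdjacent⇒disagree false x h = trans (sym (not-involutive x)) h

-- Deleting the vertices of high disagreement

record ConsistentSubgraph {N₀} (T : Tournament N₀) (N K : ℕ) : Set where
  field
    embedding      : Fin N → Fin N₀
    injective      : Injective _≡_ _≡_ embedding
    graph          : OrderedGraph N
    consistent     : Consistent graph (induced T embedding injective)
    nonNeighbours≤ : ∀ v → nonNeighbours graph v ≤ K

module _ {N₀} (T S : Tournament N₀) (K : ℕ) where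

  lowDisagreement : Fin N₀ → Bool
  lowDisagreement a = does (count (disagree T S a) ≤? K)

  count-highDisagreement : suc K * count (not ∘ lowDisagreement) ≤ distance T S + distance T S
  count-highDisagreement = subst (suc K * count (not ∘ lowDisagreement) ≤_) (sumFin-count-disagree T S)
    (markov (count ∘ disagree T S) (not ∘ lowDisagreement) K
      (λ a high → ≰⇒> (not-does≡true⇒¬ (count (disagree T S a) ≤? K) high)))

  lowDisagreementSubgraph : Transitive S → ConsistentSubgraph T (count lowDisagreement) K
  lowDisagreementSubgraph S-transitive = record
    { embedding      = f
    ; injective      = f-injective
    ; graph          = agreementGraph T′ S′ S′-transitive
    ; consistent     = agreementGraph-consistent T′ S′ S′-transitive
    ; nonNeighbours≤ = λ v → begin
        nonNeighbours (agreementGraph T′ S′ S′-transitive) v  ≤⟨ nonNeighbours-agreementGraph T′ S′ S′-transitive v ⟩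
        count (disagree T′ S′ v)                              ≤⟨ sumFin-enumerate-≤ lowDisagreement (bool→ℕ ∘ disagree T S (f v)) ⟩
        count (disagree T S (f v))                            ≤⟨ does≡true⇒ (_ ≤? K) (enumerate-sound lowDisagreement v) ⟩
        K                                                     ∎
    }
    where
    open ≤-Reasoning
    f : Fin (count lowDisagreement) → Fin N₀
    f = enumerate lowDisagreement
    f-injective : Injective _≡_ _≡_ f
    f-injective = enumerate-injective lowDisagreement
    T′ S′ : Tournament (count lowDisagreement)
    T′ = induced T f f-injective
    S′ = induced S f f-injective
    S′-transitive : Transitive S′
    S′-transitive u v w = S-transitive (f u) (f v) (f w)

m<[1+m/n]*n : ∀ m n .{{_ : NonZero n}} → m < suc (m ℕ./ n) * n
m<[1+m/n]*n m n = begin-strict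
  m                          ≡⟨ m≡m%n+[m/n]*n m n ⟩
  m ℕ.% n + m ℕ./ n * n      <⟨ +-monoˡ-< (m ℕ./ n * n) (m%n<n m n) ⟩
  suc (m ℕ./ n) * n          ∎
  where open ≤-Reasoning

deleted-bound : ∀ X q D K B → D * (q * q) ≤ X * X → X + X < suc K * q → suc K * B ≤ D + D → B * q ≤ X
deleted-bound X q D K B D≤X² X+X<[1+K]q [1+K]B≤D+D = *-cancelˡ-≤ (suc (X + X)) (begin
  suc (X + X) * (B * q)      ≤⟨ *-monoˡ-≤ (B * q) X+X<[1+K]q ⟩
  (suc K * q) * (B * q)      ≡⟨ *-interchange (suc K) q B q ⟩
  (suc K * B) * (q * q)      ≤⟨ *-monoˡ-≤ (q * q) [1+K]B≤D+D ⟩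
  (D + D) * (q * q)          ≡⟨ *-distribʳ-+ (q * q) D D ⟩
  D * (q * q) + D * (q * q)  ≤⟨ +-mono-≤ D≤X² D≤X² ⟩
  X * X + X * X              ≡⟨ *-distribʳ-+ X X X ⟨
  (X + X) * X                ≤⟨ *-monoˡ-≤ X (n≤1+n (X + X)) ⟩
  suc (X + X) * X            ∎)
  where open ≤-Reasoning

remaining-bound : ∀ n q N B {N₀} → N + B ≡ N₀ → B * q ≤ n * N₀ → (q ∸ n) * N₀ ≤ N * q
remaining-bound n q N B {N₀} refl Bq≤nN₀ = begin
  (q ∸ n) * N₀       ≡⟨ *-distribʳ-∸ N₀ q n ⟩
  q * N₀ ∸ n * N₀    ≤⟨ m≤n+o⇒m∸n≤o (q * N₀) (n * N₀) qN₀≤nN₀+Nq ⟩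
  N * q              ∎
  where
  open ≤-Reasoning
  qN₀≤nN₀+Nq : q * N₀ ≤ n * N₀ + N * q
  qN₀≤nN₀+Nq = begin
    q * (N + B)        ≡⟨ *-comm q (N + B) ⟩
    (N + B) * q        ≡⟨ *-distribʳ-+ q N B ⟩
    N * q + B * q      ≤⟨ +-monoʳ-≤ (N * q) Bq≤nN₀ ⟩
    N * q + n * N₀     ≡⟨ +-comm (N * q) (n * N₀) ⟩
    n * N₀ + N * q     ∎

threshold-bound : ∀ n q N B {N₀} k → n * 2 ≤ q → N + B ≡ N₀ → B * q ≤ n * N₀ →
  k * q ≤ n * N₀ + n * N₀ → k * q ≤ 4 * n * N
threshold-bound n q N B {N₀} k 2n≤q refl Bq≤nN₀ kq≤2nN₀ = begin
  k * q                                ≤⟨ kq≤2nN₀ ⟩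
  n * (N + B) + n * (N + B)            ≡⟨ cong₂ _+_ (*-distribˡ-+ n N B) (*-distribˡ-+ n N B) ⟩
  (n * N + n * B) + (n * N + n * B)    ≤⟨ +-mono-≤ (+-monoʳ-≤ (n * N) nB≤nN) (+-monoʳ-≤ (n * N) nB≤nN) ⟩
  (n * N + n * N) + (n * N + n * N)    ≡⟨ four-times (n * N) ⟩
  4 * (n * N)                          ≡⟨ *-assoc 4 n N ⟨
  4 * n * N                            ∎
  where
  open ≤-Reasoning
  four-times : ∀ x → (x + x) + (x + x) ≡ 4 * x
  four-times = solve-∀
  double : ∀ x → x + x ≡ x * 2
  double = solve-∀
  nB+nB≤nN+nB : n * B + n * B ≤ n * N + n * B
  nB+nB≤nN+nB = begin
    n * B + n * B      ≡⟨ *-distribʳ-+ B n n ⟨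
    (n + n) * B        ≡⟨ cong (_* B) (double n) ⟩
    (n * 2) * B        ≤⟨ *-monoˡ-≤ B 2n≤q ⟩
    q * B              ≡⟨ *-comm q B ⟩
    B * q              ≤⟨ Bq≤nN₀ ⟩
    n * (N + B)        ≡⟨ *-distribˡ-+ n N B ⟩
    n * N + n * B      ∎
  nB≤nN : n * B ≤ n * N
  nB≤nN = +-cancelʳ-≤ (n * B) (n * B) (n * N) nB+nB≤nN+nB

open import Data.Integer as ℤ using (+_; -[1+_])
import Data.Integer.Properties as ℤ
open import Data.Rational as ℚ using (ℚ; mkℚ; toℚᵘ; 0ℚ; 1ℚ; ½)
import Data.Rational.Properties as ℚ
open import Data.Rational.Unnormalised as ℚᵘ using (mkℚᵘ; *≤*; *<*) renaming (_≃_ to _≃ᵘ_)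
import Data.Rational.Unnormalised.Properties as ℚᵘ

toℚᵘ-ℕ→ℚ : ∀ k → toℚᵘ (ℕ→ℚ k) ≃ᵘ mkℚᵘ (+ k) 0
toℚᵘ-ℕ→ℚ k = ℚ.toℚᵘ-fromℚᵘ (mkℚᵘ (+ k) 0)

toℚᵘ-*-≃ : ∀ {p r a b} → toℚᵘ p ≃ᵘ a → toℚᵘ r ≃ᵘ b → toℚᵘ (p ℚ.* r) ≃ᵘ a ℚᵘ.* b
toℚᵘ-*-≃ {p} {r} p≃a r≃b = ℚᵘ.≃-trans (ℚ.toℚᵘ-homo-* p r) (ℚᵘ.*-cong p≃a r≃b)

toℚᵘ---≃ : ∀ {p r a b} → toℚᵘ p ≃ᵘ a → toℚᵘ r ≃ᵘ b → toℚᵘ (p ℚ.- r) ≃ᵘ a ℚᵘ.- b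
toℚᵘ---≃ {p} {r} p≃a r≃b = ℚᵘ.≃-trans (ℚ.toℚᵘ-homo-+ p (ℚ.- r))
  (ℚᵘ.+-cong p≃a (ℚᵘ.≃-trans (ℚ.toℚᵘ-homo‿- r) (ℚᵘ.-‿cong r≃b)))

≤-fromℚᵘ : ∀ {p r a b} → toℚᵘ p ≃ᵘ a → toℚᵘ r ≃ᵘ b → a ℚᵘ.≤ b → p ℚ.≤ r
≤-fromℚᵘ p≃a r≃b a≤b = ℚ.toℚᵘ-cancel-≤ (ℚᵘ.≤-respˡ-≃ (ℚᵘ.≃-sym p≃a) (ℚᵘ.≤-respʳ-≃ (ℚᵘ.≃-sym r≃b) a≤b))

≤-toℚᵘ : ∀ {p r a b} → toℚᵘ p ≃ᵘ a → toℚᵘ r ≃ᵘ b → p ℚ.≤ r → a ℚᵘ.≤ b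
≤-toℚᵘ p≃a r≃b p≤r = ℚᵘ.≤-respˡ-≃ p≃a (ℚᵘ.≤-respʳ-≃ r≃b (ℚ.toℚᵘ-mono-≤ p≤r))

-- δ is the fraction n / q with q = suc d, and each rational inequality is the ℕ inequality
-- obtained by cross-multiplying unnormalised representatives.
module _ (δ : ℚ) {n d : ℕ} (δ≃n/q : toℚᵘ δ ≃ᵘ mkℚᵘ (+ n) d) where

  private
    q = suc d

    1*q*1≡q : 1 * q * 1 ≡ q
    1*q*1≡q = trans (*-identityʳ (1 * q)) (*-identityˡ q)

  δ<½⇒n*2<q : δ ℚ.< ½ → n * 2 < q
  δ<½⇒n*2<q δ<½ with ℚᵘ.<-respˡ-≃ δ≃n/q (ℚ.toℚᵘ-mono-< δ<½)
  ... | *<* n*2<1*q = ℤ.drop‿+<+ (subst₂ ℤ._<_ (sym (ℤ.pos-* n 2)) (ℤ.*-identityˡ (+ q)) n*2<1*q)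

  D≤δ²M⇒Dq²≤n²M : ∀ D M → ℕ→ℚ D ℚ.≤ δ ℚ.* δ ℚ.* ℕ→ℚ M → D * (q * q) ≤ (n * n) * M
  D≤δ²M⇒Dq²≤n²M D M D≤δ²M with ≤-toℚᵘ (toℚᵘ-ℕ→ℚ D) (toℚᵘ-*-≃ (toℚᵘ-*-≃ δ≃n/q δ≃n/q) (toℚᵘ-ℕ→ℚ M)) D≤δ²M
  ... | *≤* cross = ℤ.drop‿+≤+ (subst₂ ℤ._≤_ lhs rhs cross)
    where
    open ≡-Reasoning
    lhs : + D ℤ.* + (q * q * 1) ≡ + (D * (q * q))
    lhs = begin
      + D ℤ.* + (q * q * 1)  ≡⟨ ℤ.pos-* D (q * q * 1) ⟨
      + (D * (q * q * 1))    ≡⟨ cong (λ x → + (D * x)) (*-identityʳ (q * q)) ⟩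
      + (D * (q * q))        ∎
    rhs : + n ℤ.* + n ℤ.* + M ℤ.* + 1 ≡ + (n * n * M)
    rhs = begin
      + n ℤ.* + n ℤ.* + M ℤ.* + 1  ≡⟨ ℤ.*-identityʳ _ ⟩
      + n ℤ.* + n ℤ.* + M          ≡⟨ cong (ℤ._* + M) (ℤ.pos-* n n) ⟨
      + (n * n) ℤ.* + M            ≡⟨ ℤ.pos-* (n * n) M ⟨
      + (n * n * M)                ∎

  [q∸n]N₀≤Nq⇒[1-δ]N₀≤N : ∀ {N₀} N → n ≤ q → (q ∸ n) * N₀ ≤ N * q → (1ℚ ℚ.- δ) ℚ.* ℕ→ℚ N₀ ℚ.≤ ℕ→ℚ N
  [q∸n]N₀≤Nq⇒[1-δ]N₀≤N {N₀} N n≤q [q-n]N₀≤Nq =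
    ≤-fromℚᵘ (toℚᵘ-*-≃ (toℚᵘ---≃ (toℚᵘ-ℕ→ℚ 1) δ≃n/q) (toℚᵘ-ℕ→ℚ N₀)) (toℚᵘ-ℕ→ℚ N)
      (*≤* (subst₂ ℤ._≤_ lhs rhs (ℤ.+≤+ [q-n]N₀≤Nq)))
    where
    open ≡-Reasoning
    lhs : + ((q ∸ n) * N₀) ≡ (+ 1 ℤ.* + q ℤ.+ ℤ.- + n ℤ.* + 1) ℤ.* + N₀ ℤ.* + 1
    lhs = sym (begin
      (+ 1 ℤ.* + q ℤ.+ ℤ.- + n ℤ.* + 1) ℤ.* + N₀ ℤ.* + 1
        ≡⟨ ℤ.*-identityʳ _ ⟩
      (+ 1 ℤ.* + q ℤ.+ ℤ.- + n ℤ.* + 1) ℤ.* + N₀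
        ≡⟨ cong (ℤ._* + N₀) (cong₂ ℤ._+_ (ℤ.*-identityˡ (+ q)) (ℤ.*-identityʳ (ℤ.- + n))) ⟩
      (+ q ℤ.- + n) ℤ.* + N₀
        ≡⟨ cong (ℤ._* + N₀) (trans (ℤ.m-n≡m⊖n q n) (ℤ.⊖-≥ n≤q)) ⟩
      + (q ∸ n) ℤ.* + N₀
        ≡⟨ ℤ.pos-* (q ∸ n) N₀ ⟨
      + ((q ∸ n) * N₀)
        ∎)
    rhs : + (N * q) ≡ + N ℤ.* + (1 * q * 1)
    rhs = begin
      + (N * q)            ≡⟨ cong (λ x → + (N * x)) 1*q*1≡q ⟨
      + (N * (1 * q * 1))  ≡⟨ ℤ.pos-* N (1 * q * 1) ⟩
      + N ℤ.* + (1 * q * 1) ∎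

  kq≤4nN⇒k≤4δN : ∀ k N → k * q ≤ 4 * n * N → ℕ→ℚ k ℚ.≤ (+ 4 ℚ./ 1) ℚ.* δ ℚ.* ℕ→ℚ N
  kq≤4nN⇒k≤4δN k N kq≤4nN =
    ≤-fromℚᵘ (toℚᵘ-ℕ→ℚ k) (toℚᵘ-*-≃ (toℚᵘ-*-≃ (toℚᵘ-ℕ→ℚ 4) δ≃n/q) (toℚᵘ-ℕ→ℚ N))
      (*≤* (subst₂ ℤ._≤_ lhs rhs (ℤ.+≤+ kq≤4nN)))
    where
    open ≡-Reasoning
    lhs : + (k * q) ≡ + k ℤ.* + (1 * q * 1)
    lhs = begin
      + (k * q)              ≡⟨ cong (λ x → + (k * x)) 1*q*1≡q ⟨
      + (k * (1 * q * 1))    ≡⟨ ℤ.pos-* k (1 * q * 1) ⟩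
      + k ℤ.* + (1 * q * 1)  ∎
    rhs : + (4 * n * N) ≡ + 4 ℤ.* + n ℤ.* + N ℤ.* + 1
    rhs = begin
      + (4 * n * N)                ≡⟨ ℤ.pos-* (4 * n) N ⟩
      + (4 * n) ℤ.* + N            ≡⟨ cong (ℤ._* + N) (ℤ.pos-* 4 n) ⟩
      + 4 ℤ.* + n ℤ.* + N          ≡⟨ ℤ.*-identityʳ _ ⟨
      + 4 ℤ.* + n ℤ.* + N ℤ.* + 1  ∎

lemma4p2 : (δ : ℚ) → 0ℚ ℚ.< δ → δ ℚ.< ½ →
    (N₀ : ℕ) (T₀ : Tournament N₀) → CloseToTransitive (δ ℚ.* δ) T₀ →
    Σ ℕ λ N → ((1ℚ ℚ.- δ) ℚ.* ℕ→ℚ N₀ ℚ.≤ ℕ→ℚ N) ×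
      Σ (Fin N → Fin N₀) λ f → Σ (Injective _≡_ _≡_ f) λ inj →
        Σ (OrderedGraph N) λ G → Consistent G (induced T₀ f inj) ×
          (∀ v → ℕ→ℚ (nonNeighbours G v) ℚ.≤ (+ 4 ℚ./ 1) ℚ.* δ ℚ.* ℕ→ℚ N)
-- The hypothesis 0 < δ is only needed to rule out a negative numerator.
lemma4p2 (mkℚ -[1+ _ ] _ _) (ℚ.*<* ()) _ _ _ _
lemma4p2 δ@(mkℚ (+ n) d _) _ δ<½ N₀ T₀ (S , S-transitive , dist≤δ²N₀²) =
  N , [q∸n]N₀≤Nq⇒[1-δ]N₀≤N δ δ≃n/q N n≤q (remaining-bound n q N B N+B≡N₀ Bq≤X) ,
  embedding , injective , graph , consistent ,
  λ v → kq≤4nN⇒k≤4δN δ δ≃n/q (nonNeighbours graph v) N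
          (threshold-bound n q N B (nonNeighbours graph v) (<⇒≤ n*2<q) N+B≡N₀ Bq≤X
            (≤-trans (*-monoˡ-≤ q (nonNeighbours≤ v)) (m/n*n≤m (X + X) q)))
  where
  q X K N B : ℕ
  q = suc d
  X = n * N₀
  K = (X + X) ℕ./ q  -- ⌊2δN₀⌋
  low : Fin N₀ → Bool
  low = lowDisagreement T₀ S K
  N = count low
  B = count (not ∘ low)
  open ConsistentSubgraph (lowDisagreementSubgraph T₀ S K S-transitive)

  δ≃n/q : toℚᵘ δ ≃ᵘ mkℚᵘ (+ n) d
  δ≃n/q = ℚᵘ.≃-refl
  n*2<q : n * 2 < q
  n*2<q = δ<½⇒n*2<q δ δ≃n/q δ<½
  n≤q : n ≤ q
  n≤q = ≤-trans (m≤m*n n 2) (<⇒≤ n*2<q)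
  N+B≡N₀ : N + B ≡ N₀
  N+B≡N₀ = count-complement low
  D≤X² : distance T₀ S * (q * q) ≤ X * X
  D≤X² = subst (distance T₀ S * (q * q) ≤_) (*-interchange n n N₀ N₀) (D≤δ²M⇒Dq²≤n²M δ δ≃n/q (distance T₀ S) (N₀ * N₀) dist≤δ²N₀²)
  Bq≤X : B * q ≤ X
  Bq≤X = deleted-bound X q (distance T₀ S) K B D≤X² (m<[1+m/n]*n (X + X) q) (count-highDisagreement T₀ S K)
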